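{- Let $(G,q)$ be a finite connected loopless multigraph with a distinguished vertex $q$, $n=|V(G)|$, and genus $g=|E(G)|-|V(G)|+1$. (1) For every $0\le k\le g$ and every oriented $k$-spanning tree $\mathcal T$ of $(G,q)$, the divisor $D_{\mathcal T}$ is $q$-reduced. (2) For every $q$-reduced divisor $D$ with $D(q)=-1$ and $\deg(D)=k-1$ for some $0\le k\le g$, there exists an oriented $k$-spanning tree $\mathcal T$ of $(G,q)$ with $D_{\mathcal T}$ linearly equivalent to $D$.
   Context: Oriented edges: each edge gives two oriented edges $e,\bar e$ with head $e_+$ and tail $e_-$. An oriented $k$-spanning tree of $(G,q)$ is a set $\mathcal T$ of oriented edges of $G$ with $|\mathcal T|=n-1+k$, such that the subgraph on all of $V(G)$ with edge set $\mathcal T$ is connected, contains no directed cycle, and has $q$ as its unique source (every edge of $\mathcal T$ incident to $q$ has tail $q$, and $q$ is the only vertex with this property). For a set $\mathcal P$ of oriented edges, $D_{\mathcal P}=\sum_v(\mathrm{indeg}_{\mathcal P}(v)-1)(v)$, where $\mathrm{indeg}_{\mathcal P}(v)$ is the number of $e\in\mathcal P$ with head $v$. A divisor $D=\sum_v D(v)(v)$ (integer coefficients) has degree $\sum_v D(v)$. $D$ is $q$-reduced if $D(v)\ge0$ for all $v\ne q$, and for every nonempty $A\subseteq V(G)\setminus\{q\}$ there is $v\in A$ with $D(v)$ strictly less than the number of edges of $G$ joining $v$ to a vertex of $V(G)\setminus A$. Linear equivalence: $D_2=D_1-\Delta(f)$ for some $f:V(G)\to\mathbb Z$, where $\Delta(f)=\sum_v\sum_{\{v,w\}\in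 E(G)}(f(v)-f(w))(v)$. -}

module Defs where

open import Data.Nat using (ℕ; zero; suc; _+_; _∸_; _≤_)
open import Data.Integer as ℤ using (ℤ; +_; _-_)
open import Data.Fin using (Fin; zero; suc; _≟_)
open import Data.Fin.Subset using (Subset; _∈_; _∉_; Nonempty)
open import Data.Fin.Subset.Properties using (_∈?_)
open import Data.Bool using (Bool; true; false; T; if_then_else_; _∧_; _∨_; not)
open import Data.Product using (Σ; ∃; ∃-syntax; _×_; _,_; proj₁; proj₂)
open import Data.Sum using (_⊎_)
open import Relation.Nullary using (¬_; does)
open import Relation.Binary.PropositionalEquality using (_≡_; _≢_)
open import Relation.Binary.Construct.Closure.ReflexiveTransitive using (Star)
open import Relation.Binary.Construct.Closure.Transitive using (TransClosure)

-- A finite loopless multigraph: vertices Fin n, edges Fin m, each edge e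
-- joins end₁ e and end₂ e (the order only fixes a reference orientation).
record Multigraph : Set where
  field
    n m      : ℕ
    end₁     : Fin m → Fin n
    end₂     : Fin m → Fin n
    loopless : ∀ e → end₁ e ≢ end₂ e
open Multigraph public

sumℕ : ∀ {k} → (Fin k → ℕ) → ℕ
sumℕ {zero}  f = 0
sumℕ {suc k} f = f zero + sumℕ (λ i → f (suc i))

sumℤ : ∀ {k} → (Fin k → ℤ) → ℤ
sumℤ {zero}  f = + 0
sumℤ {suc k} f = f zero ℤ.+ sumℤ (λ i → f (suc i))

count : ∀ {k} → (Fin k → Bool) → ℕ
count f = sumℕ (λ i → if f i then 1 else 0)

module _ (G : Multigraph) where

  Vertex = Fin (n G)
  Edge   = Fin (m G)

  Adj : Vertex → Vertex → Set
  Adj u v = ∃[ e ] ((end₁ G e ≡ u × end₂ G e ≡ v) ⊎ (end₁ G e ≡ v × end₂ G e ≡ u))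

  Connected : Set
  Connected = ∀ u v → Star Adj u v

  genus-bound : ℕ → Set   -- k ≤ g  where g = |E| - |V| + 1, i.e. k + |V| ≤ |E| + 1
  genus-bound k = k + n G ≤ m G + 1

  -- Oriented edges: (e , true) is e oriented end₁ → end₂, (e , false) is ē.
  OEdge = Edge × Bool

  head tail : OEdge → Vertex
  head (e , true)  = end₂ G e
  head (e , false) = end₁ G e
  tail (e , true)  = end₁ G e
  tail (e , false) = end₂ G e

  OSet = OEdge → Bool

  size : OSet → ℕ
  size 𝒫 = sumℕ (λ e → (if 𝒫 (e , true) then 1 else 0) + (if 𝒫 (e , false) then 1 else 0))

  indeg : OSet → Vertex → ℕ
  indeg 𝒫 v = sumℕ (λ e → (if 𝒫 (e , true)  ∧ does (end₂ G e ≟ v) then 1 else 0)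
                         + (if 𝒫 (e , false) ∧ does (end₁ G e ≟ v) then 1 else 0))

  AdjIn : OSet → Vertex → Vertex → Set
  AdjIn 𝒫 u v = ∃[ o ] (T (𝒫 o) × ((tail o ≡ u × head o ≡ v) ⊎ (tail o ≡ v × head o ≡ u)))

  DStep : OSet → Vertex → Vertex → Set
  DStep 𝒫 u v = ∃[ o ] (T (𝒫 o) × tail o ≡ u × head o ≡ v)

  HasDirectedCycle : OSet → Set
  HasDirectedCycle 𝒫 = ∃[ v ] TransClosure (DStep 𝒫) v v

  IsSource : OSet → Vertex → Set
  IsSource 𝒫 v = ∀ o → T (𝒫 o) → (head o ≡ v ⊎ tail o ≡ v) → tail o ≡ v

  record OrientedSpanningTree (q : Vertex) (k : ℕ) (𝒯 : OSet) : Set where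
    field
      card       : size 𝒯 ≡ (n G ∸ 1) + k
      connected  : ∀ u v → Star (AdjIn 𝒯) u v
      acyclic    : ¬ HasDirectedCycle 𝒯
      q-source   : IsSource 𝒯 q
      q-unique   : ∀ v → IsSource 𝒯 v → v ≡ q

  Divisor = Vertex → ℤ

  deg : Divisor → ℤ
  deg D = sumℤ D

  D[_] : OSet → Divisor
  D[ 𝒫 ] v = + indeg 𝒫 v - + 1

  outEdges : Subset (n G) → Vertex → ℕ
  outEdges A v = count (λ e →
      (does (end₁ G e ≟ v) ∧ not (does (end₂ G e ∈? A)))
    ∨ (does (end₂ G e ≟ v) ∧ not (does (end₁ G e ∈? A))))

  QReduced : Vertex → Divisor → Set
  QReduced q D =
      (∀ v → v ≢ q → + 0 ℤ.≤ D v)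
    × (∀ (A : Subset (n G)) → Nonempty A → q ∉ A →
         ∃[ v ] (v ∈ A × D v ℤ.< + outEdges A v))

  Δ : (Vertex → ℤ) → Divisor
  Δ f v = sumℤ (λ e →
      (if does (end₁ G e ≟ v) then f (end₁ G e) - f (end₂ G e) else + 0)
    ℤ.+ (if does (end₂ G e ≟ v) then f (end₂ G e) - f (end₁ G e) else + 0))

  LinEquiv : Divisor → Divisor → Set
  LinEquiv D₁ D₂ = ∃[ f ] (∀ v → D₂ v ≡ D₁ v - Δ f v)

-- (1) A vertex v ≠ q of in-degree 0 would be a second source, so D_𝒯 ≥ 0 away from q.
-- Given a nonempty A, acyclicity of 𝒯 yields a vertex v ∈ A that no edge of 𝒯 enters from
-- inside A, so indeg v ≤ outEdges A v and D_𝒯(v) < outEdges A v.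
-- (2) Run Dhar's burning algorithm from q: q-reducedness keeps the fire spreading until
-- every vertex burns, and more than D(v) edges join each v ≠ q to vertices that burnt
-- earlier. Orienting D(v) + 1 of them into v gives edges that strictly increase the
-- burning time, hence an oriented k-spanning tree 𝒯 with D_𝒯 = D exactly.
module Submission where

open import Defs
open import Level using (Level)
open import Data.Nat as ℕ
  using (ℕ; zero; suc; _+_; _∸_; _⊓_; _≤_; _<_; _<?_; z≤n; s≤s; s≤s⁻¹; _≤′_; ≤′-refl; ≤′-step)
open import Data.Nat.Properties
  using ( ≤-refl; ≤-reflexive; ≤-trans; <-≤-trans; ≤-<-trans; <-irrefl; <-trans; ≮⇒≥; <⇒≱; ≤⇒≤′; n<1+n
        ; +-comm; +-mono-≤; m≤m+n; m≤n+m; m≤n⇒∃[o]m+o≡n; m≤n⇒m⊓n≡m; ⊓-zeroʳ; +-0-commutativeMonoid)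
open import Data.Integer as ℤ using (ℤ; +_; -[1+_]; _-_; -_; 0ℤ)
import Data.Integer.Properties as ℤP
open import Data.Fin as Fin using (Fin; zero; suc; toℕ; _≟_)
open import Data.Fin.Properties using (any?; all?; ¬∀⟶∃¬; pigeonhole; nonZeroIndex)
open import Data.Fin.Subset using (Subset; _∈_; _∉_; _⊆_; ∣_∣; Nonempty; ∁; ⁅_⁆; _∪_)
open import Data.Fin.Subset.Properties
  using ( _∈?_; p⊂q⇒∣p∣<∣q∣; ∣p∣≤n; x∈⁅x⁆; x∈⁅y⁆⇒x≡y; p⊆p∪q; x∈p∪q⁺; x∈p∪q⁻
        ; x∉p⇒x∈∁p; x∈p⇒x∉∁p; x∈∁p⇒x∉p; x∉∁p⇒x∈p)
open import Data.Vec using (tabulate)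
open import Data.Vec.Properties using (lookup∘tabulate; lookup⇒[]=; []=⇒lookup)
open import Data.Bool using (Bool; true; false; T; if_then_else_; _∧_; _∨_)
open import Data.Bool.Properties using (T-≡; if-eta)
open import Data.Unit using (tt)
open import Data.Empty using (⊥-elim)
open import Data.Product using (Σ; ∃; ∃-syntax; _×_; _,_; proj₁; proj₂)
open import Data.Sum using (_⊎_; inj₁; inj₂)
open import Function using (_∘_; _⇔_; mk⇔; Equivalence)
import Function.Properties.Equivalence as ⇔
open import Relation.Nullary using (¬_; Dec; yes; no; does; ¬?; _×-dec_; _⊎-dec_; T?)
open import Relation.Nullary.Decidable using (map′; decidable-stable; does-⇔)
open import Relation.Unary using (Pred; Decidable)
import Relation.Binary as B
open import Relation.Binary.Definitions using (Symmetric)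
open import Relation.Binary.PropositionalEquality
  using (_≡_; _≢_; refl; sym; trans; cong; cong₂; subst; module ≡-Reasoning)
open import Relation.Binary.Construct.Closure.Transitive using (TransClosure; [_]; _∷_)
open import Relation.Binary.Construct.Closure.ReflexiveTransitive using (Star; ε; _◅_; _◅◅_; reverse)
import Relation.Binary.Construct.On as On
import Induction.WellFounded as WF
open import Data.Nat.Induction using (<-wellFounded)
open import Algebra.Properties.CommutativeMonoid.Sum +-0-commutativeMonoid
  using (sum; sum-cong-≗; ∑-distrib-+; ∑-comm)
open import Data.Integer.Tactic.RingSolver using (solve-∀)

private variable
  ℓ ℓ′ : Level
  A : Set ℓ

𝟙 : Bool → ℕ
𝟙 b = if b then 1 else 0

T-does : (a? : Dec A) → T (does a?) ⇔ A
T-does (yes a) = mk⇔ (λ _ → a) (λ _ → tt)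
T-does (no ¬a) = mk⇔ (λ ()) ¬a

𝟙-mono : ∀ {a b} → (T a → T b) → 𝟙 a ≤ 𝟙 b
𝟙-mono {false}         _   = z≤n
𝟙-mono {true} {true}   _   = ≤-refl
𝟙-mono {true} {false} a⇒b = ⊥-elim (a⇒b tt)

𝟙-+-disjoint : ∀ {a b} → ¬ (T a × T b) → 𝟙 a + 𝟙 b ≡ 𝟙 (a ∨ b)
𝟙-+-disjoint {true}  {true}  ¬ab = ⊥-elim (¬ab (tt , tt))
𝟙-+-disjoint {true}  {false} _   = refl
𝟙-+-disjoint {false}         _   = refl

T⇒𝟙-pos : ∀ {a} → T a → 0 < 𝟙 a
T⇒𝟙-pos {true} _ = s≤s z≤n

𝟙-pos⇒T : ∀ {a} → 0 < 𝟙 a → T a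
𝟙-pos⇒T {true} _ = tt

T-cong : ∀ {a b} → (T a ⇔ T b) → a ≡ b
T-cong {true}  a⇔b = sym (Equivalence.to T-≡ (Equivalence.to a⇔b tt))
T-cong {false} {false} _ = refl
T-cong {false} {true}  a⇔b = ⊥-elim (Equivalence.from a⇔b tt)

sumℕ-cong : ∀ {k} {f g : Fin k → ℕ} → (∀ i → f i ≡ g i) → sumℕ f ≡ sumℕ g
sumℕ-cong {zero}  _   = refl
sumℕ-cong {suc k} f≗g = cong₂ _+_ (f≗g zero) (sumℕ-cong (f≗g ∘ suc))

sumℕ-mono : ∀ {k} {f g : Fin k → ℕ} → (∀ i → f i ≤ g i) → sumℕ f ≤ sumℕ g
sumℕ-mono {zero}  _   = z≤n
sumℕ-mono {suc k} f≤g = +-mono-≤ (f≤g zero) (sumℕ-mono (f≤g ∘ suc))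

≤-sumℕ : ∀ {k} (f : Fin k → ℕ) i → f i ≤ sumℕ f
≤-sumℕ f zero    = m≤m+n _ _
≤-sumℕ f (suc i) = ≤-trans (≤-sumℕ (f ∘ suc) i) (m≤n+m _ _)

sumℕ-pos : ∀ {k} (f : Fin k → ℕ) → 0 < sumℕ f → ∃[ i ] 0 < f i
sumℕ-pos {suc k} f pos with f zero in eq
... | suc _ = zero , subst (0 <_) (sym eq) (s≤s z≤n)
... | zero  = let i , fi>0 = sumℕ-pos (f ∘ suc) pos in suc i , fi>0

sumℕ≡sum : ∀ {k} (f : Fin k → ℕ) → sumℕ f ≡ sum f
sumℕ≡sum {zero}  f = refl
sumℕ≡sum {suc k} f = cong₂ _+_ refl (sumℕ≡sum (f ∘ suc))

sumℕ-+ : ∀ {k} (f g : Fin k → ℕ) → sumℕ (λ i → f i + g i) ≡ sumℕ f + sumℕ g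
sumℕ-+ f g = begin
  sumℕ (λ i → f i + g i) ≡⟨ sumℕ≡sum (λ i → f i + g i) ⟩
  sum (λ i → f i + g i)  ≡⟨ ∑-distrib-+ f g ⟩
  sum f + sum g          ≡⟨ cong₂ _+_ (sumℕ≡sum f) (sumℕ≡sum g) ⟨
  sumℕ f + sumℕ g        ∎
  where open ≡-Reasoning

sumℕ²≡sum² : ∀ {k l} (f : Fin k → Fin l → ℕ) →
  sumℕ (λ i → sumℕ (f i)) ≡ sum (λ i → sum (f i))
sumℕ²≡sum² f = trans (sumℕ≡sum (λ i → sumℕ (f i))) (sum-cong-≗ (λ i → sumℕ≡sum (f i)))

sumℕ-comm : ∀ {k l} (f : Fin k → Fin l → ℕ) →
  sumℕ (λ i → sumℕ (f i)) ≡ sumℕ (λ j → sumℕ (λ i → f i j))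
sumℕ-comm f = trans (sumℕ²≡sum² f) (trans (∑-comm f) (sym (sumℕ²≡sum² (λ j i → f i j))))

sumℕ-zero : ∀ {k} → sumℕ {k} (λ _ → 0) ≡ 0
sumℕ-zero {zero}  = refl
sumℕ-zero {suc k} = sumℕ-zero {k}

sumℕ-point : ∀ {k} (w : Fin k) b → sumℕ (λ v → 𝟙 (b ∧ does (w ≟ v))) ≡ 𝟙 b
sumℕ-point {k} w false = sumℕ-zero {k}
sumℕ-point {suc k} zero true = cong suc (sumℕ-zero {k})
sumℕ-point {suc k} (suc w) true = sumℕ-point w true

sumℤ-cong : ∀ {k} {f g : Fin k → ℤ} → (∀ i → f i ≡ g i) → sumℤ f ≡ sumℤ g
sumℤ-cong {zero}  _   = refl
sumℤ-cong {suc k} f≗g = cong₂ ℤ._+_ (f≗g zero) (sumℤ-cong (f≗g ∘ suc))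

sumℤ-zero : ∀ {k} {f : Fin k → ℤ} → (∀ i → f i ≡ + 0) → sumℤ f ≡ + 0
sumℤ-zero {zero}  _    = refl
sumℤ-zero {suc k} f≗0 = cong₂ ℤ._+_ (f≗0 zero) (sumℤ-zero (f≗0 ∘ suc))

sumℤ-pred : ∀ {k} (f : Fin k → ℕ) → sumℤ (λ i → + f i - + 1) ≡ + sumℕ f - + k
sumℤ-pred {zero}  f = refl
sumℤ-pred {suc k} f = trans (cong (λ s → (+ f zero - + 1) ℤ.+ s) (sumℤ-pred (f ∘ suc)))
                            (regroup (+ f zero) (+ sumℕ (f ∘ suc)) (+ k))
  where
  regroup : ∀ x s k → (x - + 1) ℤ.+ (s - k) ≡ (x ℤ.+ s) - (+ 1 ℤ.+ k)
  regroup = solve-∀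

∣suc∣-1≡ : ∀ i → 0ℤ ℤ.≤ ℤ.suc i → + ℤ.∣ ℤ.suc i ∣ - + 1 ≡ i
∣suc∣-1≡ (+ m)          _ = refl
∣suc∣-1≡ -[1+ 0 ]       _ = refl
∣suc∣-1≡ -[1+ suc m ] ()

s-n≡k-1⇒s≡n∸1+k : ∀ {s k} n .{{_ : ℕ.NonZero n}} → + s - + n ≡ + k - + 1 → s ≡ (n ∸ 1) + k
s-n≡k-1⇒s≡n∸1+k {s} {k} (suc n) eq = ℤP.+-injective (begin
  + s                                       ≡⟨ shift (+ s) (+ n) ⟩
  (+ s - (+ 1 ℤ.+ + n)) ℤ.+ (+ 1 ℤ.+ + n)   ≡⟨ cong (λ z → z ℤ.+ (+ 1 ℤ.+ + n)) eq ⟩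
  (+ k - + 1) ℤ.+ (+ 1 ℤ.+ + n)             ≡⟨ regroup (+ k) (+ n) ⟩
  + n ℤ.+ + k                               ∎)
  where
  open ≡-Reasoning
  shift : ∀ x y → x ≡ (x - (+ 1 ℤ.+ y)) ℤ.+ (+ 1 ℤ.+ y)
  shift = solve-∀
  regroup : ∀ x y → (x - + 1) ℤ.+ (+ 1 ℤ.+ y) ≡ y ℤ.+ x
  regroup = solve-∀

least : (ℕ → Bool) → ℕ → ℕ
least p zero    = zero
least p (suc m) = if p zero then zero else suc (least (p ∘ suc) m)

least-holds : ∀ (p : ℕ → Bool) m → T (p m) → T (p (least p m))
least-holds p zero    pm = pm
least-holds p (suc m) pm with p zero in p0
... | true  = subst T (sym p0) tt
... | false = least-holds (p ∘ suc) m pm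

least-minimal : ∀ (p : ℕ → Bool) m {j} → j < least p m → ¬ T (p j)
least-minimal p (suc m) {j} j< with p zero in p0
least-minimal p (suc m) {zero}  _         | false = subst T p0
least-minimal p (suc m) {suc j} (s≤s j<) | false = least-minimal (p ∘ suc) m j<

keepFirst : ∀ {k} → ℕ → (Fin k → Bool) → Fin k → Bool
keepFirst zero    p _       = false
keepFirst (suc b) p zero    = p zero
keepFirst (suc b) p (suc i) = keepFirst (if p zero then b else suc b) (p ∘ suc) i

keepFirst⊆ : ∀ {k} b (p : Fin k → Bool) i → T (keepFirst b p i) → T (p i)
keepFirst⊆ (suc b) p zero    = λ pi → pi
keepFirst⊆ (suc b) p (suc i) = keepFirst⊆ (if p zero then b else suc b) (p ∘ suc) i

count-keepFirst : ∀ {k} b (p : Fin k → Bool) → count (keepFirst b p) ≡ b ⊓ count p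
count-keepFirst {zero}  b       p = sym (⊓-zeroʳ b)
count-keepFirst {suc k} zero    p = count-keepFirst {k} zero (p ∘ suc)
count-keepFirst {suc k} (suc b) p with p zero
... | true  = cong suc (count-keepFirst b (p ∘ suc))
... | false = count-keepFirst (suc b) (p ∘ suc)

∈-tabulate⁺ : ∀ {k} {f : Fin k → Bool} {x} → T (f x) → x ∈ tabulate f
∈-tabulate⁺ {f = f} {x} fx = lookup⇒[]= x _ (trans (lookup∘tabulate f x) (Equivalence.to T-≡ fx))

∈-tabulate⁻ : ∀ {k} {f : Fin k → Bool} {x} → x ∈ tabulate f → T (f x)
∈-tabulate⁻ {f = f} {x} x∈ = Equivalence.from T-≡ (trans (sym (lookup∘tabulate f x)) ([]=⇒lookup x∈))

module _ {k} (B : ℕ → Subset k) (B-step : ∀ i → B i ⊆ B (suc i)) where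

  ⊆-chain : ∀ {i j} → i ≤ j → B i ⊆ B j
  ⊆-chain i≤j = go (≤⇒≤′ i≤j)
    where
    go : ∀ {i j} → i ≤′ j → B i ⊆ B j
    go ≤′-refl        = λ x∈ → x∈
    go (≤′-step i≤′j) = B-step _ ∘ go i≤′j

  saturation : (∀ i v → v ∉ B i → ∃[ w ] (w ∉ B i × w ∈ B (suc i))) →
               ∀ v → v ∈ B (suc k)
  saturation grows v with full-or-large (suc k)
    where
    full-or-large : ∀ i → (∀ v → v ∈ B i) ⊎ i ≤ ∣ B i ∣
    full-or-large zero = inj₂ z≤n
    full-or-large (suc i) with full-or-large i | all? (_∈? B (suc i))
    ... | inj₁ full  | _          = inj₁ (B-step i ∘ full)
    ... | inj₂ _     | yes full   = inj₁ full
    ... | inj₂ large | no ¬full   =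
      let u , u∉ = ¬∀⟶∃¬ k _ (_∈? B (suc i)) ¬full
          w , w∉ , w∈ = grows i u (u∉ ∘ B-step i)
      in inj₂ (≤-<-trans large (p⊂q⇒∣p∣<∣q∣ (B-step i , w , w∈ , w∉)))
  ... | inj₁ full  = full v
  ... | inj₂ large = ⊥-elim (<⇒≱ (s≤s (∣p∣≤n (B (suc k)))) large)

module _ {k} {R : B.Rel (Fin k) ℓ} {P : Pred (Fin k) ℓ′} where

  predecessors⇒cycle : (∀ {v} → P v → ∃[ u ] (P u × R u v)) → ∃ P → ∃[ v ] TransClosure R v v
  predecessors⇒cycle pred (v₀ , pv₀) = close (pigeonhole (n<1+n k) (x ∘ toℕ))
    where
    walk : ℕ → Σ (Fin k) P
    walk zero    = v₀ , pv₀
    walk (suc t) = let u , pu , _ = pred (proj₂ (walk t)) in u , pu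
    x : ℕ → Fin k
    x = proj₁ ∘ walk
    step : ∀ t → R (x (suc t)) (x t)
    step t = proj₂ (proj₂ (pred (proj₂ (walk t))))
    chain : ∀ t d → TransClosure R (x (d + suc t)) (x t)
    chain t zero    = [ step t ]
    chain t (suc d) = step (d + suc t) ∷ chain t d
    close : (∃[ i ] ∃[ j ] (i Fin.< j × x (toℕ i) ≡ x (toℕ j))) → ∃[ v ] TransClosure R v v
    close (i , j , i<j , xi≡xj) with d , i+d≡j ← m≤n⇒∃[o]m+o≡n i<j =
      x (toℕ i) , subst (λ y → TransClosure R y (x (toℕ i)))
                        (trans (cong x (trans (+-comm d _) i+d≡j)) (sym xi≡xj))
                        (chain (toℕ i) d)

  module _ (P? : Decidable P) (R? : B.Decidable R) where

    private
      entered? : ∀ v → Dec (∃[ u ] (P u × R u v))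
      entered? v = any? (λ u → P? u ×-dec R? u v)

    acyclic⇒minimal : ¬ (∃[ v ] TransClosure R v v) → ∃ P → ∃[ v ] (P v × ¬ (∃[ u ] (P u × R u v)))
    acyclic⇒minimal acyclic ∃P with any? (λ v → P? v ×-dec ¬? (entered? v))
    ... | yes minimal = minimal
    ... | no ¬minimal = ⊥-elim (acyclic (predecessors⇒cycle predecessor ∃P))
      where
      predecessor : ∀ {v} → P v → ∃[ u ] (P u × R u v)
      predecessor {v} pv = decidable-stable (entered? v) (λ ¬∃ → ¬minimal (v , pv , ¬∃))

module _ (G : Multigraph) where

  Joins : Pred (Vertex G) ℓ → Vertex G → Edge G → Set ℓ
  Joins P v e = (end₁ G e ≡ v × P (end₂ G e)) ⊎ (end₂ G e ≡ v × P (end₁ G e))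

  joins? : {P : Pred (Vertex G) ℓ} → Decidable P → ∀ v e → Dec (Joins P v e)
  joins? P? v e = ((end₁ G e ≟ v) ×-dec P? (end₂ G e)) ⊎-dec ((end₂ G e ≟ v) ×-dec P? (end₁ G e))

  -- outEdges G A v is, definitionally, edgesTo (λ w → ¬? (w ∈? A)) v.
  edgesTo : {P : Pred (Vertex G) ℓ} → Decidable P → Vertex G → ℕ
  edgesTo P? v = count (λ e → does (joins? P? v e))

  Joins-map : {P : Pred (Vertex G) ℓ} {Q : Pred (Vertex G) ℓ′} →
              (∀ {w} → P w → Q w) → ∀ {v e} → Joins P v e → Joins Q v e
  Joins-map P⇒Q (inj₁ (end₁≡v , Pw)) = inj₁ (end₁≡v , P⇒Q Pw)
  Joins-map P⇒Q (inj₂ (end₂≡v , Pw)) = inj₂ (end₂≡v , P⇒Q Pw)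

  edgesTo-cong : {P : Pred (Vertex G) ℓ} {Q : Pred (Vertex G) ℓ′} (P? : Decidable P) (Q? : Decidable Q) →
                 (∀ {w} → P w ⇔ Q w) → ∀ v → edgesTo P? v ≡ edgesTo Q? v
  edgesTo-cong {P = P} {Q} P? Q? P⇔Q v = sumℕ-cong λ e → cong 𝟙 (does-⇔ Joins⇔ (joins? P? v e) (joins? Q? v e))
    where
    Joins⇔ : ∀ {e} → Joins P v e ⇔ Joins Q v e
    Joins⇔ = mk⇔ (Joins-map (λ {w} → Equivalence.to (P⇔Q {w}))) (Joins-map (λ {w} → Equivalence.from (P⇔Q {w})))

  head≢tail : ∀ o → head G o ≢ tail G o
  head≢tail (e , true)  = loopless G e ∘ sym
  head≢tail (e , false) = loopless G e

  Arrives : OSet G → Vertex G → OEdge G → Set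
  Arrives 𝒫 v o = T (𝒫 o) × head G o ≡ v

  arrives? : ∀ 𝒫 v o → Dec (Arrives 𝒫 v o)
  arrives? 𝒫 v o = T? (𝒫 o) ×-dec (head G o ≟ v)

  ArrivesAlong : OSet G → Vertex G → Edge G → Set
  ArrivesAlong 𝒫 v e = Arrives 𝒫 v (e , true) ⊎ Arrives 𝒫 v (e , false)

  arrivesAlong? : ∀ 𝒫 v e → Dec (ArrivesAlong 𝒫 v e)
  arrivesAlong? 𝒫 v e = arrives? 𝒫 v (e , true) ⊎-dec arrives? 𝒫 v (e , false)

  -- indeg G 𝒫 v is, definitionally, sumℕ (arrivals 𝒫 v).
  arrivals : OSet G → Vertex G → Edge G → ℕ
  arrivals 𝒫 v e = 𝟙 (does (arrives? 𝒫 v (e , true))) + 𝟙 (does (arrives? 𝒫 v (e , false)))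

  arrivals≡𝟙 : ∀ 𝒫 v e → arrivals 𝒫 v e ≡ 𝟙 (does (arrivesAlong? 𝒫 v e))
  arrivals≡𝟙 𝒫 v e = 𝟙-+-disjoint λ (fwd , bwd) →
    loopless G e (trans (proj₂ (Equivalence.to (T-does (arrives? 𝒫 v (e , false))) bwd))
                        (sym (proj₂ (Equivalence.to (T-does (arrives? 𝒫 v (e , true))) fwd))))

  arrivals-≤ : ∀ 𝒫 v e {c} → (ArrivesAlong 𝒫 v e → T c) → arrivals 𝒫 v e ≤ 𝟙 c
  arrivals-≤ 𝒫 v e arrives⇒c = ≤-trans (≤-reflexive (arrivals≡𝟙 𝒫 v e))
    (𝟙-mono (arrives⇒c ∘ Equivalence.to (T-does (arrivesAlong? 𝒫 v e))))

  arrivals-≡ : ∀ 𝒫 v e {c} → ArrivesAlong 𝒫 v e ⇔ T c → arrivals 𝒫 v e ≡ 𝟙 c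
  arrivals-≡ 𝒫 v e arrives⇔c =
    trans (arrivals≡𝟙 𝒫 v e) (cong 𝟙 (T-cong (⇔.trans (T-does (arrivesAlong? 𝒫 v e)) arrives⇔c)))

  arrival⇒indeg-pos : ∀ 𝒫 {v} o → Arrives 𝒫 v o → 0 < indeg G 𝒫 v
  arrival⇒indeg-pos 𝒫 {v} (e , x) arrival = <-≤-trans positive (≤-sumℕ (arrivals 𝒫 v) e)
    where
    along : ∀ x → Arrives 𝒫 v (e , x) → ArrivesAlong 𝒫 v e
    along true  = inj₁
    along false = inj₂
    positive : 0 < arrivals 𝒫 v e
    positive = subst (0 <_) (sym (arrivals≡𝟙 𝒫 v e))
                 (T⇒𝟙-pos (Equivalence.from (T-does (arrivesAlong? 𝒫 v e)) (along x arrival)))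

  indeg-pos⇒arrival : ∀ 𝒫 {v} → 0 < indeg G 𝒫 v → ∃[ o ] Arrives 𝒫 v o
  indeg-pos⇒arrival 𝒫 {v} pos with e , positive ← sumℕ-pos (arrivals 𝒫 v) pos
    with Equivalence.to (T-does (arrivesAlong? 𝒫 v e))
                        (𝟙-pos⇒T (subst (0 <_) (arrivals≡𝟙 𝒫 v e) positive))
  ... | inj₁ arrival = (e , true) , arrival
  ... | inj₂ arrival = (e , false) , arrival

  indeg≡0⇒source : ∀ 𝒫 {v} → indeg G 𝒫 v ≡ 0 → IsSource G 𝒫 v
  indeg≡0⇒source 𝒫 indeg≡0 o 𝒫o (inj₁ head≡v) =
    ⊥-elim (<-irrefl refl (subst (0 <_) indeg≡0 (arrival⇒indeg-pos 𝒫 o (𝒫o , head≡v))))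
  indeg≡0⇒source 𝒫 indeg≡0 o 𝒫o (inj₂ tail≡v) = tail≡v

  size≡∑indeg : ∀ 𝒫 → size G 𝒫 ≡ sumℕ (indeg G 𝒫)
  size≡∑indeg 𝒫 = sym (begin
    sumℕ (λ v → sumℕ (λ e → into v e + out v e))
      ≡⟨ sumℕ-comm (λ v e → into v e + out v e) ⟩
    sumℕ (λ e → sumℕ (λ v → into v e + out v e))
      ≡⟨ sumℕ-cong (λ e → sumℕ-+ (λ v → into v e) (λ v → out v e)) ⟩
    sumℕ (λ e → sumℕ (λ v → into v e) + sumℕ (λ v → out v e))
      ≡⟨ sumℕ-cong (λ e → cong₂ _+_ (sumℕ-point (end₂ G e) (𝒫 (e , true)))
                                    (sumℕ-point (end₁ G e) (𝒫 (e , false)))) ⟩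
    size G 𝒫
      ∎)
    where
    open ≡-Reasoning
    into out : Vertex G → Edge G → ℕ
    into v e = 𝟙 (𝒫 (e , true) ∧ does (end₂ G e ≟ v))
    out  v e = 𝟙 (𝒫 (e , false) ∧ does (end₁ G e ≟ v))

  deg-D : ∀ 𝒫 → deg G (D[_] G 𝒫) ≡ + size G 𝒫 - + n G
  deg-D 𝒫 = trans (sumℤ-pred (indeg G 𝒫)) (cong (λ s → + s - + n G) (sym (size≡∑indeg 𝒫)))

  linEquiv-reflexive : ∀ {D₁ D₂} → (∀ v → D₂ v ≡ D₁ v) → LinEquiv G D₁ D₂
  linEquiv-reflexive {D₁} D₂≗D₁ = (λ _ → + 0) , λ v →
    trans (D₂≗D₁ v) (sym (trans (cong (λ δ → D₁ v - δ) (Δ-zero v)) (ℤP.+-identityʳ (D₁ v))))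
    where
    Δ-zero : ∀ v → Δ G (λ _ → + 0) v ≡ + 0
    Δ-zero v = sumℤ-zero λ e → cong₂ ℤ._+_ (if-eta (does (end₁ G e ≟ v))) (if-eta (does (end₂ G e ≟ v)))

  Ascends : (Vertex G → ℕ) → OSet G → Set
  Ascends r 𝒫 = ∀ o → T (𝒫 o) → r (tail G o) < r (head G o)

  ascends⇒acyclic : ∀ {r 𝒫} → Ascends r 𝒫 → ¬ HasDirectedCycle G 𝒫
  ascends⇒acyclic {r} {𝒫} ascends (v , cycle) = <-irrefl refl (rises cycle)
    where
    rises : ∀ {u w} → TransClosure (DStep G 𝒫) u w → r u < r w
    rises [ o , 𝒫o , refl , refl ]         = ascends o 𝒫o
    rises ((o , 𝒫o , refl , refl) ∷ walk) = <-trans (ascends o 𝒫o) (rises walk)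

  AdjIn-sym : ∀ {𝒫} → Symmetric (AdjIn G 𝒫)
  AdjIn-sym (o , 𝒫o , inj₁ ends) = o , 𝒫o , inj₂ ends
  AdjIn-sym (o , 𝒫o , inj₂ ends) = o , 𝒫o , inj₁ ends

  ascends⇒reachable : ∀ {r 𝒫 q} → Ascends r 𝒫 → (∀ v → v ≢ q → ∃[ o ] Arrives 𝒫 v o) →
                      ∀ v → Star (AdjIn G 𝒫) q v
  ascends⇒reachable {r} {𝒫} {q} ascends entered =
    WF.All.wfRec (On.wellFounded r <-wellFounded) _ (Star (AdjIn G 𝒫) q) reach
    where
    reach : ∀ v → (∀ {u} → r u < r v → Star (AdjIn G 𝒫) q u) → Star (AdjIn G 𝒫) q v
    reach v below with v ≟ q
    ... | yes refl = ε
    ... | no v≢q   = let o , 𝒫o , head≡v = entered v v≢q in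
      below (subst (λ w → r (tail G o) < r w) head≡v (ascends o 𝒫o))
        ◅◅ ((o , 𝒫o , inj₁ (refl , head≡v)) ◅ ε)

  ascending-tree : ∀ {q k 𝒫} r → Ascends r 𝒫 → indeg G 𝒫 q ≡ 0 → (∀ v → v ≢ q → 0 < indeg G 𝒫 v) →
                   size G 𝒫 ≡ (n G ∸ 1) + k → OrientedSpanningTree G q k 𝒫
  ascending-tree {q} {𝒫 = 𝒫} r ascends q-unentered entered card = record
    { card      = card
    ; connected = λ u v → reverse AdjIn-sym (reach u) ◅◅ reach v
    ; acyclic   = ascends⇒acyclic {r} ascends
    ; q-source  = indeg≡0⇒source 𝒫 q-unentered
    ; q-unique  = unique
    }
    where
    arrival : ∀ v → v ≢ q → ∃[ o ] Arrives 𝒫 v o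
    arrival v v≢q = indeg-pos⇒arrival 𝒫 (entered v v≢q)
    reach : ∀ v → Star (AdjIn G 𝒫) q v
    reach = ascends⇒reachable {r} ascends arrival
    unique : ∀ v → IsSource G 𝒫 v → v ≡ q
    unique v source with v ≟ q
    ... | yes v≡q = v≡q
    ... | no v≢q  = let o , 𝒫o , head≡v = arrival v v≢q in
      ⊥-elim (head≢tail o (trans head≡v (sym (source o 𝒫o (inj₁ head≡v)))))

  any-oriented? : {P : Pred (OEdge G) ℓ} → Decidable P → Dec (∃ P)
  any-oriented? P? = map′ (λ { (e , inj₁ p) → (e , true) , p ; (e , inj₂ p) → (e , false) , p })
                          (λ { ((e , true) , p) → e , inj₁ p ; ((e , false) , p) → e , inj₂ p })
                          (any? λ e → P? (e , true) ⊎-dec P? (e , false))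

  DStep? : ∀ 𝒫 → B.Decidable (DStep G 𝒫)
  DStep? 𝒫 u v = any-oriented? λ o → T? (𝒫 o) ×-dec (tail G o ≟ u) ×-dec (head G o ≟ v)

  indeg-≤ : ∀ 𝒫 v {P : Pred (Vertex G) ℓ} (P? : Decidable P) →
            (∀ o → Arrives 𝒫 v o → P (tail G o)) → indeg G 𝒫 v ≤ edgesTo P? v
  indeg-≤ 𝒫 v {P} P? tails = sumℕ-mono λ e →
    arrivals-≤ 𝒫 v e (Equivalence.from (T-does (joins? P? v e)) ∘ joins)
    where
    joins : ∀ {e} → ArrivesAlong 𝒫 v e → Joins P v e
    joins (inj₁ arrival) = inj₂ (proj₂ arrival , tails _ arrival)
    joins (inj₂ arrival) = inj₁ (proj₂ arrival , tails _ arrival)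

  -- Reducedness of D_𝒯

  tree⇒reduced : ∀ {q k 𝒯} → OrientedSpanningTree G q k 𝒯 → QReduced G q (D[_] G 𝒯)
  tree⇒reduced {q} {𝒯 = 𝒯} tree = nonneg , fires
    where
    open OrientedSpanningTree tree
    nonneg : ∀ v → v ≢ q → + 0 ℤ.≤ D[_] G 𝒯 v
    nonneg v v≢q with indeg G 𝒯 v in indeg≡
    ... | zero  = ⊥-elim (v≢q (q-unique v (indeg≡0⇒source 𝒯 indeg≡)))
    ... | suc _ = ℤ.+≤+ z≤n
    fires : ∀ A → Nonempty A → q ∉ A → ∃[ v ] (v ∈ A × D[_] G 𝒯 v ℤ.< + outEdges G A v)
    fires A nonempty _ with v , v∈A , unentered ← acyclic⇒minimal (_∈? A) (DStep? 𝒯) acyclic nonempty =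
      v , v∈A , ℤP.<-≤-trans (ℤP.m⊖1+n<m (indeg G 𝒯 v) 1)
                              (ℤ.+≤+ (indeg-≤ 𝒯 v (λ w → ¬? (w ∈? A)) from-outside))
      where
      from-outside : ∀ o → Arrives 𝒯 v o → tail G o ∉ A
      from-outside o (𝒯o , head≡v) tail∈A = unentered (tail G o , tail∈A , o , 𝒯o , refl , head≡v)

  -- Spanning trees from q-reduced divisors

  joins-head⇒tail : ∀ o {P : Pred (Vertex G) ℓ} → Joins P (head G o) (proj₁ o) → P (tail G o)
  joins-head⇒tail (e , true)  (inj₁ (loop , _)) = ⊥-elim (loopless G e loop)
  joins-head⇒tail (e , true)  (inj₂ (_ , P-tail)) = P-tail
  joins-head⇒tail (e , false) (inj₁ (_ , P-tail)) = P-tail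
  joins-head⇒tail (e , false) (inj₂ (loop , _)) = ⊥-elim (loopless G e (sym loop))

  module Descent (r : Vertex G → ℕ) (b : Vertex G → ℕ) where

    below? : ∀ v → Decidable (λ w → r w < r v)
    below? v w = r w <? r v

    feeds : Vertex G → Edge G → Bool
    feeds v e = does (joins? (below? v) v e)

    𝒯 : OSet G
    𝒯 o = keepFirst (b (head G o)) (feeds (head G o)) (proj₁ o)

    𝒯-ascends : Ascends r 𝒯
    𝒯-ascends o 𝒯o = joins-head⇒tail o {λ w → r w < r (head G o)}
      (Equivalence.to (T-does (joins? (below? (head G o)) (head G o) (proj₁ o)))
                      (keepFirst⊆ (b (head G o)) (feeds (head G o)) (proj₁ o) 𝒯o))

    indeg-𝒯 : ∀ v → indeg G 𝒯 v ≡ b v ⊓ edgesTo (below? v) v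
    indeg-𝒯 v = trans (sumℕ-cong λ e → arrivals-≡ 𝒯 v e (mk⇔ (kept e) (arrives e)))
                      (count-keepFirst (b v) (feeds v))
      where
      kept : ∀ e → ArrivesAlong 𝒯 v e → T (keepFirst (b v) (feeds v) e)
      kept e (inj₁ (𝒯o , head≡v)) = subst (λ w → T (keepFirst (b w) (feeds w) e)) head≡v 𝒯o
      kept e (inj₂ (𝒯o , head≡v)) = subst (λ w → T (keepFirst (b w) (feeds w) e)) head≡v 𝒯o
      arrives : ∀ e → T (keepFirst (b v) (feeds v) e) → ArrivesAlong 𝒯 v e
      arrives e k with Equivalence.to (T-does (joins? (below? v) v e)) (keepFirst⊆ (b v) (feeds v) e k)
      ... | inj₁ (end₁≡v , _) = inj₂ (subst (λ w → T (keepFirst (b w) (feeds w) e)) (sym end₁≡v) k , end₁≡v)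
      ... | inj₂ (end₂≡v , _) = inj₁ (subst (λ w → T (keepFirst (b w) (feeds w) e)) (sym end₂≡v) k , end₂≡v)

  -- Dhar's burning algorithm: a vertex catches fire once more of its edges lead into
  -- the fire than it holds chips.
  module Burning (q : Vertex G) (D : Divisor G) (reduced : QReduced G q D) where

    ignites : Subset (n G) → Subset (n G)
    ignites B = tabulate (λ v → does (D v ℤ.<? + outEdges G (∁ B) v))

    burnt : ℕ → Subset (n G)
    burnt zero    = ⁅ q ⁆
    burnt (suc i) = burnt i ∪ ignites (burnt i)

    burnt-step : ∀ i → burnt i ⊆ burnt (suc i)
    burnt-step i = p⊆p∪q (ignites (burnt i))

    q-burnt : ∀ i → q ∈ burnt i
    q-burnt i = ⊆-chain burnt burnt-step {0} {i} z≤n (x∈⁅x⁆ q)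

    burnt-grows : ∀ i v → v ∉ burnt i → ∃[ w ] (w ∉ burnt i × w ∈ burnt (suc i))
    burnt-grows i v v∉
      with w , w∈ , fires ← proj₂ reduced (∁ (burnt i)) (v , x∉p⇒x∈∁p v∉) (x∈p⇒x∉∁p (q-burnt i)) =
      w , x∈∁p⇒x∉p w∈ , x∈p∪q⁺ (inj₂ (∈-tabulate⁺ (Equivalence.from (T-does (D w ℤ.<? _)) fires)))

    burnt-at : Vertex G → ℕ → Bool
    burnt-at v i = does (v ∈? burnt i)

    rank : Vertex G → ℕ
    rank v = least (burnt-at v) (suc (n G))

    burnt-rank : ∀ v → v ∈ burnt (rank v)
    burnt-rank v = Equivalence.to (T-does (v ∈? burnt (rank v))) (least-holds (burnt-at v) (suc (n G))
      (Equivalence.from (T-does (v ∈? burnt (suc (n G)))) (saturation burnt burnt-step burnt-grows v)))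

    burnt⇔rank≤ : ∀ {i v} → v ∈ burnt i ⇔ rank v ≤ i
    burnt⇔rank≤ {i} {v} = mk⇔
      (λ v∈ → ≮⇒≥ λ i<rank → least-minimal (burnt-at v) (suc (n G)) i<rank
                                 (Equivalence.from (T-does (v ∈? burnt i)) v∈))
      (λ rank≤i → ⊆-chain burnt burnt-step {rank v} {i} rank≤i (burnt-rank v))

    rank-fires : ∀ v → v ≢ q → D v ℤ.< + edgesTo (λ w → rank w <? rank v) v
    rank-fires v v≢q with rank v in rank≡ | burnt-rank v
    ... | zero  | v∈ = ⊥-elim (v≢q (x∈⁅y⁆⇒x≡y q v∈))
    ... | suc j | v∈ with x∈p∪q⁻ (burnt j) (ignites (burnt j)) v∈
    ...   | inj₁ v∈burnt = ⊥-elim (<-irrefl refl (subst (_≤ j) rank≡ (Equivalence.to burnt⇔rank≤ v∈burnt)))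
    ...   | inj₂ v∈ignites = subst (λ c → D v ℤ.< + c)
        (edgesTo-cong (λ w → ¬? (w ∈? ∁ (burnt j))) (λ w → rank w <? suc j) burnt⇔below v) fires
      where
      fires : D v ℤ.< + outEdges G (∁ (burnt j)) v
      fires = Equivalence.to (T-does (D v ℤ.<? _)) (∈-tabulate⁻ v∈ignites)
      burnt⇔below : ∀ {w} → w ∉ ∁ (burnt j) ⇔ rank w < suc j
      burnt⇔below = mk⇔ (s≤s ∘ Equivalence.to burnt⇔rank≤ ∘ x∉∁p⇒x∈p)
                        (x∈p⇒x∉∁p ∘ Equivalence.from burnt⇔rank≤ ∘ s≤s⁻¹)

  reduced⇒tree : ∀ {q k} D → QReduced G q D → D q ≡ - (+ 1) → deg G D ≡ + k - + 1 →
                 ∃[ 𝒯 ] (OrientedSpanningTree G q k 𝒯 × LinEquiv G D (D[_] G 𝒯))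
  reduced⇒tree {q} {k} D reduced Dq≡-1 deg≡ =
    𝒯 , ascending-tree rank 𝒯-ascends q-unentered entered card , linEquiv-reflexive D[𝒯]≗D
    where
    open Burning q D reduced
    -- D v + 1 edges will enter v; none enter q, as D q = -1.
    budget : Vertex G → ℕ
    budget v = ℤ.∣ ℤ.suc (D v) ∣
    open Descent rank budget

    budget-fits : ∀ v → budget v ≤ edgesTo (below? v) v
    budget-fits v with v ≟ q
    ... | yes refl rewrite Dq≡-1 = z≤n
    ... | no v≢q with D v | proj₁ reduced v v≢q | rank-fires v v≢q
    ...   | + m | _ | m<edges = ℤP.drop‿+<+ m<edges

    indeg≡budget : ∀ v → indeg G 𝒯 v ≡ budget v
    indeg≡budget v = trans (indeg-𝒯 v) (m≤n⇒m⊓n≡m (budget-fits v))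

    q-unentered : indeg G 𝒯 q ≡ 0
    q-unentered = trans (indeg≡budget q) (cong (λ d → ℤ.∣ ℤ.suc d ∣) Dq≡-1)

    entered : ∀ v → v ≢ q → 0 < indeg G 𝒯 v
    entered v v≢q rewrite indeg≡budget v with D v | proj₁ reduced v v≢q
    ... | + m | _ = s≤s z≤n

    D[𝒯]≗D : ∀ v → D[_] G 𝒯 v ≡ D v
    D[𝒯]≗D v = trans (cong (λ d → + d - + 1) (indeg≡budget v)) (∣suc∣-1≡ (D v) (D≥-1 v))
      where
      D≥-1 : ∀ v → 0ℤ ℤ.≤ ℤ.suc (D v)
      D≥-1 v with v ≟ q
      ... | yes refl rewrite Dq≡-1 = ℤ.+≤+ z≤n
      ... | no v≢q with D v | proj₁ reduced v v≢q
      ...   | + m | _ = ℤ.+≤+ z≤n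

    card : size G 𝒯 ≡ (n G ∸ 1) + k
    card = s-n≡k-1⇒s≡n∸1+k (n G) {{nonZeroIndex q}}
             (trans (sym (deg-D 𝒯)) (trans (sumℤ-cong D[𝒯]≗D) deg≡))

theorem3p10 : (G : Multigraph) → Connected G → (q : Vertex G) →
    ((k : ℕ) → genus-bound G k → (𝒯 : OSet G) →
       OrientedSpanningTree G q k 𝒯 → QReduced G q (D[_] G 𝒯))
    ×
    ((D : Divisor G) → QReduced G q D → D q ≡ - (+ 1) →
       (k : ℕ) → genus-bound G k → deg G D ≡ + k - + 1 →
       ∃[ 𝒯 ] (OrientedSpanningTree G q k 𝒯 × LinEquiv G D (D[_] G 𝒯)))
theorem3p10 G _ q =
  (λ k _ 𝒯 tree → tree⇒reduced G tree) ,
  (λ D reduced Dq≡-1 k _ deg≡ → reduced⇒tree G D reduced Dq≡-1 deg≡)
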